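{- There exists a unit-interval graph $G$ with $g(G)\neq s(G)$. Moreover, for every integer $k\ge 0$ there exists a unit-interval graph $G$ with $s(G)-g(G)\ge k$.
   Context: A unit-interval graph is the intersection graph of a finite family of closed intervals of the real line all of the same length. For a graph $G=(V,E)$ and $S\subseteq V$, $I(S)$ is the set of vertices lying on some shortest $x,y$-path with $x,y\in S$; $S$ is geodetic if $I(S)=V$ and $g(G)$ is the minimum size of a geodetic set. For $W\subseteq V$, a Steiner $W$-tree is a connected subgraph containing $W$ with the minimum possible number of edges; $S(W)$ is the set of vertices in some Steiner $W$-tree; $W$ is a Steiner set if $S(W)=V$; $s(G)$ is the minimum size of a Steiner set. -}

module Defs where

open import Data.Nat as ℕ using (ℕ; zero; suc)
open import Data.Fin using (Fin; toℕ)
open import Data.Fin.Subset using (Subset; _∈_; _⊆_; ∣_∣; Nonempty)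
open import Data.Bool using (Bool; true; false)
open import Data.Product using (Σ; ∃; _×_; _,_)
open import Data.Sum using (_⊎_)
open import Relation.Nullary using (¬_)
open import Relation.Binary.PropositionalEquality using (_≡_; _≢_)
open import Data.Rational using (ℚ; _+_; 1ℚ) renaming (_≤_ to _≤ℚ_)

Rel : ℕ → Set₁
Rel n = Fin n → Fin n → Set

-- The vertex i is the closed interval [p i , p i + 1]; all intervals have
-- length 1.  Two distinct vertices are adjacent iff their intervals meet,
-- i.e. |p i - p j| ≤ 1.  (Endpoints rational.)

UIAdj : ∀ {n} → (Fin n → ℚ) → Rel n
UIAdj p i j = (i ≢ j) × ((p i ≤ℚ p j + 1ℚ) × (p j ≤ℚ p i + 1ℚ))

data Walk {n} (R : Rel n) : Fin n → Fin n → ℕ → Set where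
  []  : ∀ {x} → Walk R x x zero
  _∷_ : ∀ {x y z k} → R x y → Walk R y z k → Walk R x z (suc k)

OnWalk : ∀ {n} {R : Rel n} {x y k} → Fin n → Walk R x y k → Set
OnWalk {x = x} v []            = v ≡ x
OnWalk {x = x} v (_ ∷ w)       = (v ≡ x) ⊎ OnWalk v w

-- a shortest x,y-walk (= shortest x,y-path)
IsShortest : ∀ {n} {R : Rel n} {x y k} → Walk R x y k → Set
IsShortest {R = R} {x} {y} {k} _ = ∀ m → m ℕ.< k → ¬ Walk R x y m

InInterval : ∀ {n} → Rel n → Subset n → Fin n → Set
InInterval {n} E S v =
  Σ (Fin n) λ x → Σ (Fin n) λ y → x ∈ S × y ∈ S ×
  Σ ℕ λ k → Σ (Walk E x y k) λ w → IsShortest w × OnWalk v w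

IsGeodetic : ∀ {n} → Rel n → Subset n → Set
IsGeodetic E S = ∀ v → InInterval E S v

IsGeodeticNumber : ∀ {n} → Rel n → ℕ → Set
IsGeodeticNumber {n} E m =
  (Σ (Subset n) λ S → IsGeodetic E S × ∣ S ∣ ≡ m) ×
  (∀ (S : Subset n) → IsGeodetic E S → m ℕ.≤ ∣ S ∣)

boolToℕ : Bool → ℕ
boolToℕ true  = 1
boolToℕ false = 0

sumFin : ∀ {n} → (Fin n → ℕ) → ℕ
sumFin {zero}  f = zero
sumFin {suc n} f = f Data.Fin.zero ℕ.+ sumFin (λ i → f (Data.Fin.suc i))

andB : Bool → Bool → Bool
andB true b  = b
andB false _ = false

edgeCount : ∀ {n} → (Fin n → Fin n → Bool) → ℕ
edgeCount F = sumFin λ i → sumFin λ j → boolToℕ (andB (toℕ i ℕ.<ᵇ toℕ j) (F i j))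

record ConnSubgraph {n} (E : Rel n) (W : Subset n) : Set where
  field
    U        : Subset n
    F        : Fin n → Fin n → Bool
    F-sym    : ∀ i j → F i j ≡ F j i
    F-edge   : ∀ i j → F i j ≡ true → E i j × i ∈ U × j ∈ U
    conn     : ∀ u v → u ∈ U → v ∈ U →
               Σ ℕ λ k → Walk (λ a b → F a b ≡ true) u v k
    contains : W ⊆ U

open ConnSubgraph public

IsSteinerTree : ∀ {n} (E : Rel n) (W : Subset n) → ConnSubgraph E W → Set
IsSteinerTree E W T = ∀ (T' : ConnSubgraph E W) → edgeCount (F T) ℕ.≤ edgeCount (F T')

InSteinerInterval : ∀ {n} → Rel n → Subset n → Fin n → Set
InSteinerInterval E W v =
  Nonempty W × Σ (ConnSubgraph E W) λ T → IsSteinerTree E W T × v ∈ U T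

IsSteinerSet : ∀ {n} → Rel n → Subset n → Set
IsSteinerSet E W = ∀ v → InSteinerInterval E W v

IsSteinerNumber : ∀ {n} → Rel n → ℕ → Set
IsSteinerNumber {n} E m =
  (Σ (Subset n) λ W → IsSteinerSet E W × ∣ W ∣ ≡ m) ×
  (∀ (W : Subset n) → IsSteinerSet E W → m ℕ.≤ ∣ W ∣)

-- The example has intervals starting at 0 (one vertex, class L), 1/2 (m vertices, class A),
-- 1 (one vertex, H), 3/2 (m vertices, B) and 2 (one vertex, R): H sees everything, A, H, B form a
-- clique, L sees A and H, and R sees H and B. The diameter is 2, so a vertex outside a geodetic
-- set is the middle of an induced path x – v – y with x, y in the set. The ends L and R are
-- simplicial, hence in every geodetic set, and the only such path through an A-vertex is L – A – B
-- (symmetrically A – B – R), so {L, R, A₁, B₁} is a minimum geodetic set and g = 4.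
--
-- Steiner trees are compared by vertex counts: a connected subgraph on U has at least |U| - 1 edges,
-- while a parent function on U that decreases a height gives a spanning tree with exactly |U| - 1,
-- so a Steiner W-tree has at most as many vertices as any such U ⊇ W. Hence the ends lie in every
-- Steiner set W; if W contains neighbours of both ends, W spans itself and is everything; if no
-- vertex of W sees R, a Steiner tree through an A-vertex outside W would need two vertices outside
-- W although W ∪ {H} is spanned by a tree, so all A-vertices are in W. Either way |W| ≥ m + 2,
-- which {L, R} ∪ A attains: s = m + 2.

module Submission where

open import Defs
open import Data.Bool using (Bool; true; false; _∧_; _∨_; not; if_then_else_)
import Data.Bool as Bool
open import Data.Bool.Properties using (∨-comm; ∧-conicalˡ; ∧-conicalʳ)
open import Data.Empty using (⊥; ⊥-elim)
open import Data.Fin using (Fin; zero; suc; toℕ)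
open import Data.Fin.Properties using (_≟_; any?)
open import Data.Fin.Subset as Subset
  using (Subset; _∈_; _∉_; _⊆_; ∣_∣; Nonempty; inside; outside; _∪_; ⁅_⁆; _-_)
open import Data.Fin.Subset.Properties
  using ( _∈?_; ⊆-refl; p⊆q⇒∣p∣≤∣q∣; p⊂q⇒∣p∣<∣q∣; p⊆p∪q; q⊆p∪q; x∈p∪q⁺; x∈p∪q⁻; x∈⁅x⁆; x∈⁅y⁆⇒x≡y
        ; ∣⁅x⁆∣≡1; ∣⊥∣≡0; p─q⊆p; x∈p∧x≢y⇒x∈p-y; x∈p⇒∣p-x∣<∣p∣ )
open import Data.List using (length)
open import Data.List.Relation.Unary.All as All using (All; []; _∷_)
open import Data.List.Relation.Unary.AllPairs using ([]; _∷_)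
open import Data.List.Relation.Unary.Unique.Propositional using (Unique)
open import Data.Nat using (ℕ; zero; suc; _+_; _*_; _≤_; _<_; z≤n; s≤s; _<ᵇ_)
open import Data.Nat.Properties
  using ( ≤-refl; ≤-reflexive; ≤-trans; ≤-pred; <-irrefl; <-asym; ≮⇒≥; <⇒≱; n≤1+n; m≤n+m
        ; +-assoc; +-comm; +-suc; +-identityʳ; *-identityʳ; +-mono-≤; +-monoʳ-≤; module ≤-Reasoning )
open import Data.Nat.Tactic.RingSolver using (solve-∀)
open import Data.Product using (Σ; ∃; _×_; _,_; proj₁; proj₂)
open import Data.Rational using (ℚ; 0ℚ; 1ℚ; ½) renaming (_≤_ to _≤ℚ_; _+_ to _+ℚ_)
open import Data.Rational.Properties using () renaming (_≤?_ to _≤ℚ?_)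
open import Data.Sum using (_⊎_; inj₁; inj₂; [_,_]′)
open import Data.Vec using (Vec; []; _∷_; lookup; map; here; there)
open import Data.Vec.Properties using (lookup-map; lookup⇒[]=; []=⇒lookup)
open import Function using (_∘_)
open import Relation.Binary.PropositionalEquality
open import Relation.Nullary using (¬_; ¬?; Dec; yes; no; does; _×-dec_; _⊎-dec_)
open import Relation.Nullary.Decidable using (dec-true; dec-false)

does-true : ∀ {a} {A : Set a} (a? : Dec A) → does a? ≡ true → A
does-true (yes a) _ = a

does∧not-true : ∀ {A B : Set} (a? : Dec A) (b? : Dec B) → (does a? ∧ not (does b?)) ≡ true → A × ¬ B
does∧not-true (yes a) (no ¬b) _ = a , ¬b

∨-true : ∀ {a b} → (a ∨ b) ≡ true → a ≡ true ⊎ b ≡ true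
∨-true {true}  _       = inj₁ refl
∨-true {false} b≡true  = inj₂ b≡true

boolToℕ≤1 : ∀ b → boolToℕ b ≤ 1
boolToℕ≤1 true  = ≤-refl
boolToℕ≤1 false = z≤n

boolToℕ-∨ : ∀ a b → boolToℕ (a ∨ b) ≤ boolToℕ a + boolToℕ b
boolToℕ-∨ true  _ = s≤s z≤n
boolToℕ-∨ false _ = ≤-refl

sumFin-cong : ∀ {n} {f g : Fin n → ℕ} → (∀ i → f i ≡ g i) → sumFin f ≡ sumFin g
sumFin-cong {zero}  _   = refl
sumFin-cong {suc n} f≗g = cong₂ _+_ (f≗g zero) (sumFin-cong (λ i → f≗g (suc i)))

sumFin-mono : ∀ {n} {f g : Fin n → ℕ} → (∀ i → f i ≤ g i) → sumFin f ≤ sumFin g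
sumFin-mono {zero}  _   = z≤n
sumFin-mono {suc n} f≤g = +-mono-≤ (f≤g zero) (sumFin-mono (λ i → f≤g (suc i)))

sumFin-+ : ∀ {n} (f g : Fin n → ℕ) → sumFin (λ i → f i + g i) ≡ sumFin f + sumFin g
sumFin-+ {zero}  f g = refl
sumFin-+ {suc n} f g = begin
  (f zero + g zero) + sumFin (λ i → f (suc i) + g (suc i))
    ≡⟨ cong ((f zero + g zero) +_) (sumFin-+ (λ i → f (suc i)) (λ i → g (suc i))) ⟩
  (f zero + g zero) + (sumFin (λ i → f (suc i)) + sumFin (λ i → g (suc i)))
    ≡⟨ +-interchange (f zero) (g zero) _ _ ⟩
  (f zero + sumFin (λ i → f (suc i))) + (g zero + sumFin (λ i → g (suc i))) ∎
  where
  open ≡-Reasoning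
  +-interchange : ∀ a b c d → (a + b) + (c + d) ≡ (a + c) + (b + d)
  +-interchange = solve-∀

sumFin-zero : ∀ {n} {f : Fin n → ℕ} → (∀ i → f i ≡ 0) → sumFin f ≡ 0
sumFin-zero {zero}  _    = refl
sumFin-zero {suc n} f≗0 = cong₂ _+_ (f≗0 zero) (sumFin-zero (λ i → f≗0 (suc i)))

sumFin-≟ : ∀ {n} (p : Fin n) → sumFin (λ i → boolToℕ (does (i ≟ p))) ≡ 1
sumFin-≟ {suc n} zero    = cong suc (sumFin-zero {n} (λ _ → refl))
sumFin-≟ {suc n} (suc p) = sumFin-≟ p

∣p∣≡sumFin : ∀ {n} (p : Subset n) → ∣ p ∣ ≡ sumFin (λ i → boolToℕ (does (i ∈? p)))
∣p∣≡sumFin []            = refl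
∣p∣≡sumFin (inside ∷ p)  = cong suc (∣p∣≡sumFin p)
∣p∣≡sumFin (outside ∷ p) = ∣p∣≡sumFin p

pairSum : ∀ {n} → (Fin n → Fin n → ℕ) → ℕ
pairSum h = sumFin λ i → sumFin λ j → if toℕ i <ᵇ toℕ j then h i j else 0

pairSum-mono : ∀ {n} {g h : Fin n → Fin n → ℕ} → (∀ i j → g i j ≤ h i j) → pairSum g ≤ pairSum h
pairSum-mono g≤h = sumFin-mono λ i → sumFin-mono λ j → if-mono (toℕ i <ᵇ toℕ j) (g≤h i j)
  where
  if-mono : ∀ b {x y} → x ≤ y → (if b then x else 0) ≤ (if b then y else 0)
  if-mono true  x≤y = x≤y
  if-mono false _   = z≤n

edgeCount≡pairSum : ∀ {n} (F : Fin n → Fin n → Bool) → edgeCount F ≡ pairSum (λ i j → boolToℕ (F i j))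
edgeCount≡pairSum F = sumFin-cong λ i → sumFin-cong λ j → boolToℕ-andB (toℕ i <ᵇ toℕ j) (F i j)
  where
  boolToℕ-andB : ∀ b x → boolToℕ (andB b x) ≡ (if b then boolToℕ x else 0)
  boolToℕ-andB true  _ = refl
  boolToℕ-andB false _ = refl

sumFin²≡pairSum+diagonal : ∀ {n} (g : Fin n → Fin n → ℕ) →
  sumFin (λ i → sumFin (g i)) ≡ pairSum (λ i j → g i j + g j i) + sumFin (λ i → g i i)
sumFin²≡pairSum+diagonal {zero}  g = refl
sumFin²≡pairSum+diagonal {suc n} g = begin
  (g₀₀ + X) + sumFin (λ i → g (suc i) zero + sumFin (g′ i))
    ≡⟨ cong ((g₀₀ + X) +_) (sumFin-+ (λ i → g (suc i) zero) (λ i → sumFin (g′ i))) ⟩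
  (g₀₀ + X) + (Y + sumFin (λ i → sumFin (g′ i)))
    ≡⟨ cong (λ s → (g₀₀ + X) + (Y + s)) (sumFin²≡pairSum+diagonal g′) ⟩
  (g₀₀ + X) + (Y + (P′ + D′))
    ≡⟨ rearrange g₀₀ X Y P′ D′ ⟩
  ((X + Y) + P′) + (g₀₀ + D′)
    ≡⟨ cong (λ s → (s + P′) + (g₀₀ + D′)) (sym (sumFin-+ (λ j → g zero (suc j)) (λ j → g (suc j) zero))) ⟩
  (sumFin (λ j → g zero (suc j) + g (suc j) zero) + P′) + (g₀₀ + D′) ∎
  where
  open ≡-Reasoning
  g′ : Fin n → Fin n → ℕ
  g′ i j = g (suc i) (suc j)
  g₀₀ X Y P′ D′ : ℕ
  g₀₀ = g zero zero
  X   = sumFin (λ j → g zero (suc j))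
  Y   = sumFin (λ i → g (suc i) zero)
  P′  = pairSum (λ i j → g′ i j + g′ j i)
  D′  = sumFin (λ i → g′ i i)
  rearrange : ∀ a x y p d → (a + x) + (y + (p + d)) ≡ ((x + y) + p) + (a + d)
  rearrange = solve-∀

∣p∪q∣≤∣p∣+∣q∣ : ∀ {n} (p q : Subset n) → ∣ p ∪ q ∣ ≤ ∣ p ∣ + ∣ q ∣
∣p∪q∣≤∣p∣+∣q∣ []            []            = z≤n
∣p∪q∣≤∣p∣+∣q∣ (outside ∷ p) (outside ∷ q) = ∣p∪q∣≤∣p∣+∣q∣ p q
∣p∪q∣≤∣p∣+∣q∣ (outside ∷ p) (inside ∷ q)  =
  subst (suc ∣ p ∪ q ∣ ≤_) (sym (+-suc ∣ p ∣ ∣ q ∣)) (s≤s (∣p∪q∣≤∣p∣+∣q∣ p q))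
∣p∪q∣≤∣p∣+∣q∣ (inside ∷ p)  (outside ∷ q) = s≤s (∣p∪q∣≤∣p∣+∣q∣ p q)
∣p∪q∣≤∣p∣+∣q∣ (inside ∷ p)  (inside ∷ q)  =
  s≤s (≤-trans (∣p∪q∣≤∣p∣+∣q∣ p q) (+-monoʳ-≤ ∣ p ∣ (n≤1+n ∣ q ∣)))

∣p∣<∣⁅x⁆∪p∣ : ∀ {n} {p : Subset n} {x} → x ∉ p → ∣ p ∣ < ∣ ⁅ x ⁆ ∪ p ∣
∣p∣<∣⁅x⁆∪p∣ {p = p} {x} x∉p = p⊂q⇒∣p∣<∣q∣ (q⊆p∪q ⁅ x ⁆ p , x , x∈p∪q⁺ (inj₁ (x∈⁅x⁆ x)) , x∉p)

∣⁅x⁆∪p∣≤1+∣p∣ : ∀ {n} x (p : Subset n) → ∣ ⁅ x ⁆ ∪ p ∣ ≤ suc ∣ p ∣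
∣⁅x⁆∪p∣≤1+∣p∣ x p = ≤-trans (∣p∪q∣≤∣p∣+∣q∣ ⁅ x ⁆ p) (≤-reflexive (cong (_+ ∣ p ∣) (∣⁅x⁆∣≡1 x)))

⁅x⁆∪p⊆q : ∀ {n} {x} {p q : Subset n} → x ∈ q → p ⊆ q → ⁅ x ⁆ ∪ p ⊆ q
⁅x⁆∪p⊆q {x = x} {p} {q} x∈q p⊆q z∈ with x∈p∪q⁻ ⁅ x ⁆ p z∈
... | inj₁ z∈⁅x⁆ = subst (_∈ q) (sym (x∈⁅y⁆⇒x≡y x z∈⁅x⁆)) x∈q
... | inj₂ z∈p   = p⊆q z∈p

∉⁅x⁆∪p : ∀ {n} {x y} {p : Subset n} → y ≢ x → y ∉ p → y ∉ ⁅ x ⁆ ∪ p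
∉⁅x⁆∪p {x = x} {p = p} y≢x y∉p y∈ with x∈p∪q⁻ ⁅ x ⁆ p y∈
... | inj₁ y∈⁅x⁆ = y≢x (x∈⁅y⁆⇒x≡y x y∈⁅x⁆)
... | inj₂ y∈p   = y∉p y∈p

unique⇒length≤∣p∣ : ∀ {n} {p : Subset n} {xs} → Unique xs → All (_∈ p) xs → length xs ≤ ∣ p ∣
unique⇒length≤∣p∣ []                [] = z≤n
unique⇒length≤∣p∣ {p = p} (x∉xs ∷ unique) (x∈p ∷ xs⊆p) =
  ≤-trans (s≤s (unique⇒length≤∣p∣ unique (All.zipWith (λ (y∈p , x≢y) → x∈p∧x≢y⇒x∈p-y y∈p (x≢y ∘ sym))
                                                       (xs⊆p , x∉xs))))
          (x∈p⇒∣p-x∣<∣p∣ x∈p)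

-- Walks, arborescences and edge counts

choice : ∀ {n} {P : Fin n → Set} {Q : Fin n → Fin n → Set} → (∀ u → Dec (P u)) →
         (∀ {u} → P u → ∃ (Q u)) → Σ (Fin n → Fin n) λ f → ∀ {u} → P u → Q u (f u)
choice {n} {P} {Q} P? witness = f , f-spec
  where
  f : Fin n → Fin n
  f u with P? u
  ... | yes Pu = proj₁ (witness Pu)
  ... | no _   = u
  f-spec : ∀ {u} → P u → Q u (f u)
  f-spec {u} Pu with P? u
  ... | yes Pu′ = proj₂ (witness Pu′)
  ... | no ¬Pu  = ⊥-elim (¬Pu Pu)

minimalWitness : ∀ {P : ℕ → Set} → (∀ i → Dec (P i)) → ∀ {b} → P b →
                 Σ ℕ λ j → P j × (∀ i → i < j → ¬ P i)
minimalWitness P? Pb with P? 0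
... | yes P0 = 0 , P0 , λ _ ()
minimalWitness P? {zero}  Pb | no ¬P0 = ⊥-elim (¬P0 Pb)
minimalWitness {P} P? {suc b} Pb | no ¬P0 with minimalWitness {λ i → P (suc i)} (λ i → P? (suc i)) Pb
... | j , Pj , below = suc j , Pj , λ { zero _ → ¬P0 ; (suc i) (s≤s i<j) → below i i<j }

module _ {n} {R : Rel n} where

  _++ʷ_ : ∀ {x y z k l} → Walk R x y k → Walk R y z l → Walk R x z (k + l)
  []      ++ʷ w′ = w′
  (e ∷ w) ++ʷ w′ = e ∷ (w ++ʷ w′)

  _∷ʳʷ_ : ∀ {x y z k} → Walk R x y k → R y z → Walk R x z (suc k)
  []      ∷ʳʷ e′ = e′ ∷ []
  (e ∷ w) ∷ʳʷ e′ = e ∷ (w ∷ʳʷ e′)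

  reverseʷ : (∀ {a b} → R a b → R b a) → ∀ {x y k} → Walk R x y k → Walk R y x k
  reverseʷ R-sym []      = []
  reverseʷ R-sym (e ∷ w) = reverseʷ R-sym w ∷ʳʷ R-sym e

  splitʷ : ∀ {x y k} v (w : Walk R x y k) → OnWalk v w →
           Σ ℕ λ k₁ → Σ ℕ λ k₂ → Walk R x v k₁ × Walk R v y k₂ × k₁ + k₂ ≡ k
  splitʷ v []      refl        = 0 , 0 , [] , [] , refl
  splitʷ v (e ∷ w) (inj₁ refl) = 0 , _ , [] , e ∷ w , refl
  splitʷ v (e ∷ w) (inj₂ v∈w) with splitʷ v w v∈w
  ... | k₁ , k₂ , w₁ , w₂ , eq = suc k₁ , k₂ , e ∷ w₁ , w₂ , cong suc eq

record Arborescence {n} (E : Rel n) (U : Subset n) : Set where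
  field
    root          : Fin n
    root∈U        : root ∈ U
    parent        : Fin n → Fin n
    height        : Fin n → ℕ
    parent-edge   : ∀ {u} → u ∈ U → u ≢ root → E u (parent u)
    parent∈U      : ∀ {u} → u ∈ U → u ≢ root → parent u ∈ U
    height-parent : ∀ {u} → u ∈ U → u ≢ root → height (parent u) < height u

  isChild : Fin n → Bool
  isChild u = does (u ∈? U) ∧ not (does (u ≟ root))

  isChild-intro : ∀ {u} → u ∈ U → u ≢ root → isChild u ≡ true
  isChild-intro {u} u∈U u≢root =
    cong₂ (λ a b → a ∧ not b) (dec-true (u ∈? U) u∈U) (dec-false (u ≟ root) u≢root)

  isChild⇒ : ∀ {u} → isChild u ≡ true → u ∈ U × u ≢ root
  isChild⇒ {u} = does∧not-true (u ∈? U) (u ≟ root)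

  childOf : Fin n → Fin n → Bool
  childOf u w = isChild u ∧ does (w ≟ parent u)

  childOf-parent : ∀ {u} → u ∈ U → u ≢ root → childOf u (parent u) ≡ true
  childOf-parent {u} u∈U u≢root = cong₂ _∧_ (isChild-intro u∈U u≢root) (dec-true (parent u ≟ parent u) refl)

  childOf⇒ : ∀ {u w} → childOf u w ≡ true → (u ∈ U × u ≢ root) × w ≡ parent u
  childOf⇒ {u} {w} c =
    isChild⇒ (∧-conicalˡ (isChild u) _ c) , does-true (w ≟ parent u) (∧-conicalʳ (isChild u) _ c)

  parent≢ : ∀ {u} → u ∈ U → u ≢ root → parent u ≢ u
  parent≢ u∈U u≢root parent≡u = <-irrefl (cong height parent≡u) (height-parent u∈U u≢root)

  ¬childOf-both : ∀ {i j} → childOf i j ≡ true → childOf j i ≡ true → ⊥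
  ¬childOf-both {i} {j} c₁ c₂ with childOf⇒ {i} {j} c₁ | childOf⇒ {j} {i} c₂
  ... | (i∈U , i≢root) , refl | (j∈U , j≢root) , i≡parent =
    <-asym (height-parent i∈U i≢root)
           (subst (λ x → height x < height (parent i)) (sym i≡parent) (height-parent j∈U j≢root))

  1+#children≡∣U∣ : suc (sumFin (λ u → boolToℕ (isChild u))) ≡ ∣ U ∣
  1+#children≡∣U∣ = sym (begin
    ∣ U ∣                                          ≡⟨ ∣p∣≡sumFin U ⟩
    sumFin (λ u → boolToℕ (does (u ∈? U)))        ≡⟨ sumFin-cong member≡root+child ⟩
    sumFin (λ u → boolToℕ (does (u ≟ root)) + boolToℕ (isChild u))
      ≡⟨ sumFin-+ (λ u → boolToℕ (does (u ≟ root))) (λ u → boolToℕ (isChild u)) ⟩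
    sumFin (λ u → boolToℕ (does (u ≟ root))) + sumFin (λ u → boolToℕ (isChild u))
      ≡⟨ cong (_+ sumFin (λ u → boolToℕ (isChild u))) (sumFin-≟ root) ⟩
    suc (sumFin (λ u → boolToℕ (isChild u)))       ∎)
    where
    open ≡-Reasoning
    split : ∀ a b → (b ≡ true → a ≡ true) → boolToℕ a ≡ boolToℕ b + boolToℕ (a ∧ not b)
    split true  true  _ = refl
    split true  false _ = refl
    split false true  b⇒a with b⇒a refl
    ... | ()
    split false false _ = refl
    member≡root+child : ∀ u → boolToℕ (does (u ∈? U)) ≡ boolToℕ (does (u ≟ root)) + boolToℕ (isChild u)
    member≡root+child u = split _ _ λ u≡root →
      dec-true (u ∈? U) (subst (_∈ U) (sym (does-true (u ≟ root) u≡root)) root∈U)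

  pairSum-childOf : pairSum (λ i j → boolToℕ (childOf i j) + boolToℕ (childOf j i)) ≡
                    sumFin (λ u → boolToℕ (isChild u))
  pairSum-childOf = begin
    pairSum (λ i j → boolToℕ (childOf i j) + boolToℕ (childOf j i))
      ≡⟨ sym (+-identityʳ _) ⟩
    pairSum (λ i j → boolToℕ (childOf i j) + boolToℕ (childOf j i)) + 0
      ≡⟨ cong (pairSum (λ i j → boolToℕ (childOf i j) + boolToℕ (childOf j i)) +_)
              (sym (sumFin-zero no-loop)) ⟩
    pairSum (λ i j → boolToℕ (childOf i j) + boolToℕ (childOf j i)) + sumFin (λ u → boolToℕ (childOf u u))
      ≡⟨ sym (sumFin²≡pairSum+diagonal (λ i j → boolToℕ (childOf i j))) ⟩
    sumFin (λ u → sumFin (λ w → boolToℕ (childOf u w)))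
      ≡⟨ sumFin-cong one-parent ⟩
    sumFin (λ u → boolToℕ (isChild u)) ∎
    where
    open ≡-Reasoning
    no-loop : ∀ u → boolToℕ (childOf u u) ≡ 0
    no-loop u with isChild u in child
    ... | false = refl
    ... | true  = cong boolToℕ (dec-false (u ≟ parent u)
                    λ u≡parent → parent≢ (proj₁ (isChild⇒ child)) (proj₂ (isChild⇒ child)) (sym u≡parent))
    one-parent : ∀ u → sumFin (λ w → boolToℕ (childOf u w)) ≡ boolToℕ (isChild u)
    one-parent u with isChild u
    ... | true  = sumFin-≟ (parent u)
    ... | false = sumFin-zero {n} λ _ → refl

  treeEdge : Fin n → Fin n → Bool
  treeEdge i j = childOf i j ∨ childOf j i

  treeEdge-sym : ∀ i j → treeEdge i j ≡ treeEdge j i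
  treeEdge-sym i j = ∨-comm (childOf i j) (childOf j i)

  TreeEdge : Rel n
  TreeEdge i j = treeEdge i j ≡ true

  walkToRoot : ∀ {u} → u ∈ U → Σ ℕ (Walk TreeEdge u root)
  walkToRoot {u} = go (suc (height u)) ≤-refl
    where
    go : ∀ h {u} → height u < h → u ∈ U → Σ ℕ (Walk TreeEdge u root)
    go (suc h) {u} hu<h u∈U with u ≟ root
    ... | yes refl    = 0 , []
    ... | no u≢root with go h (≤-trans (height-parent u∈U u≢root) (≤-pred hu<h)) (parent∈U u∈U u≢root)
    ...   | k , w = suc k , cong (_∨ childOf (parent u) u) (childOf-parent u∈U u≢root) ∷ w

  spanningTree : (∀ {a b} → E a b → E b a) → ∀ {W} → W ⊆ U → ConnSubgraph E W
  spanningTree E-sym W⊆U = record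
    { U        = U
    ; F        = treeEdge
    ; F-sym    = treeEdge-sym
    ; F-edge   = edge
    ; conn     = λ u v u∈U v∈U → _ , proj₂ (walkToRoot u∈U) ++ʷ
                   reverseʷ (λ {a} {b} e → trans (treeEdge-sym b a) e) (proj₂ (walkToRoot v∈U))
    ; contains = W⊆U
    }
    where
    up : ∀ {i j} → childOf i j ≡ true → E i j × i ∈ U × j ∈ U
    up {i} {j} c with childOf⇒ {i} {j} c
    ... | (i∈U , i≢root) , refl = parent-edge i∈U i≢root , i∈U , parent∈U i∈U i≢root
    edge : ∀ i j → treeEdge i j ≡ true → E i j × i ∈ U × j ∈ U
    edge i j e with ∨-true {childOf i j} e
    ... | inj₁ c = up c
    ... | inj₂ c with up {j} {i} c
    ...   | e′ , j∈U , i∈U = E-sym e′ , i∈U , j∈U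

  spanningTree-edgeCount : suc (edgeCount treeEdge) ≤ ∣ U ∣
  spanningTree-edgeCount = begin
    suc (edgeCount treeEdge)
      ≡⟨ cong suc (edgeCount≡pairSum treeEdge) ⟩
    suc (pairSum (λ i j → boolToℕ (treeEdge i j)))
      ≤⟨ s≤s (pairSum-mono λ i j → boolToℕ-∨ (childOf i j) (childOf j i)) ⟩
    suc (pairSum (λ i j → boolToℕ (childOf i j) + boolToℕ (childOf j i)))
      ≡⟨ cong suc pairSum-childOf ⟩
    suc (sumFin (λ u → boolToℕ (isChild u)))
      ≡⟨ 1+#children≡∣U∣ ⟩
    ∣ U ∣ ∎
    where open ≤-Reasoning

  ∣U∣≤1+edgeCount : (F : Fin n → Fin n → Bool) → (∀ i j → F i j ≡ F j i) →
                    (∀ {u} → u ∈ U → u ≢ root → F u (parent u) ≡ true) → ∣ U ∣ ≤ suc (edgeCount F)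
  ∣U∣≤1+edgeCount F F-sym F-parent = begin
    ∣ U ∣
      ≡⟨ sym 1+#children≡∣U∣ ⟩
    suc (sumFin (λ u → boolToℕ (isChild u)))
      ≡⟨ cong suc (sym pairSum-childOf) ⟩
    suc (pairSum (λ i j → boolToℕ (childOf i j) + boolToℕ (childOf j i)))
      ≤⟨ s≤s (pairSum-mono λ i j → bound (childOf i j) (childOf j i) (F i j)
               (F-up i j) (λ c → trans (F-sym i j) (F-up j i c)) (¬childOf-both {i} {j})) ⟩
    suc (pairSum (λ i j → boolToℕ (F i j)))
      ≡⟨ cong suc (sym (edgeCount≡pairSum F)) ⟩
    suc (edgeCount F) ∎
    where
    open ≤-Reasoning
    F-up : ∀ i j → childOf i j ≡ true → F i j ≡ true
    F-up i j c with childOf⇒ {i} {j} c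
    ... | (i∈U , i≢root) , refl = F-parent i∈U i≢root
    bound : ∀ a b f → (a ≡ true → f ≡ true) → (b ≡ true → f ≡ true) → (a ≡ true → b ≡ true → ⊥) →
            boolToℕ a + boolToℕ b ≤ boolToℕ f
    bound true  true  _     _  _  ¬ab = ⊥-elim (¬ab refl refl)
    bound true  false true  _  _  _   = ≤-refl
    bound false true  true  _  _  _   = ≤-refl
    bound false false _     _  _  _   = z≤n
    bound true  false false a⇒ _  _   with a⇒ refl
    ... | ()
    bound false true  false _  b⇒ _   with b⇒ refl
    ... | ()

module _ {n} {E : Rel n} {W : Subset n} (T : ConnSubgraph E W) where

  private
    Edge : Rel n
    Edge a b = F T a b ≡ true

  Reach : Fin n → ℕ → Fin n → Set
  Reach r zero    u = u ≡ r
  Reach r (suc k) u = Reach r k u ⊎ ∃ λ w → Edge u w × Reach r k w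

  reach? : ∀ r k u → Dec (Reach r k u)
  reach? r zero    u = u ≟ r
  reach? r (suc k) u = reach? r k u ⊎-dec any? λ w → (F T u w Bool.≟ true) ×-dec reach? r k w

  walk⇒Reach : ∀ {r u k} → Walk Edge u r k → Reach r k u
  walk⇒Reach []      = refl
  walk⇒Reach (e ∷ w) = inj₂ (_ , e , walk⇒Reach w)

  connSubgraph⇒arborescence : ∀ {r} → r ∈ U T → Arborescence Edge (U T)
  connSubgraph⇒arborescence {r} r∈U = record
    { root          = r
    ; root∈U        = r∈U
    ; parent        = proj₁ parent
    ; height        = depth
    ; parent-edge   = λ u∈U u≢r → proj₁ (proj₂ parent (u∈U , u≢r))
    ; parent∈U      = λ {u} u∈U u≢r → proj₂ (proj₂ (F-edge T u _ (proj₁ (proj₂ parent (u∈U , u≢r)))))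
    ; height-parent = λ u∈U u≢r → proj₂ (proj₂ parent (u∈U , u≢r))
    }
    where
    -- breadth-first: depth is the distance to r, and a parent is a neighbour one step closer
    depth : Fin n → ℕ
    depth u with u ∈? U T
    ... | yes u∈U = proj₁ (minimalWitness (λ j → reach? r j u) (walk⇒Reach (proj₂ (conn T u r u∈U r∈U))))
    ... | no _    = 0

    depth-≤ : ∀ {w t} → Reach r t w → depth w ≤ t
    depth-≤ {w} {t} reach with w ∈? U T
    ... | no _    = z≤n
    ... | yes w∈U with minimalWitness (λ j → reach? r j w) (walk⇒Reach (proj₂ (conn T w r w∈U r∈U)))
    ...   | j , _ , below = ≮⇒≥ λ t<j → below t t<j reach

    descend : ∀ {u} → u ∈ U T → u ≢ r → ∃ λ w → Edge u w × depth w < depth u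
    descend {u} u∈U u≢r with u ∈? U T
    ... | no u∉U = ⊥-elim (u∉U u∈U)
    ... | yes u∈U′ with minimalWitness (λ j → reach? r j u) (walk⇒Reach (proj₂ (conn T u r u∈U′ r∈U)))
    ...   | zero  , u≡r , _ = ⊥-elim (u≢r u≡r)
    ...   | suc t , inj₁ reach-t , below = ⊥-elim (below t ≤-refl reach-t)
    ...   | suc t , inj₂ (w , e , reach-w) , below = w , e , s≤s (depth-≤ reach-w)

    parent : Σ (Fin n → Fin n) λ p → ∀ {u} → u ∈ U T × u ≢ r → Edge u (p u) × depth (p u) < depth u
    parent = choice (λ u → u ∈? U T ×-dec ¬? (u ≟ r)) λ (u∈U , u≢r) → descend u∈U u≢r

connSubgraph-∣U∣≤1+edgeCount : ∀ {n} {E : Rel n} {W} (T : ConnSubgraph E W) {r} → r ∈ U T →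
                               ∣ U T ∣ ≤ suc (edgeCount (F T))
connSubgraph-∣U∣≤1+edgeCount T r∈U =
  Arborescence.∣U∣≤1+edgeCount A (F T) (F-sym T) (Arborescence.parent-edge A)
  where A = connSubgraph⇒arborescence T r∈U

connSubgraph-neighbour : ∀ {n} {E : Rel n} {W} (T : ConnSubgraph E W) {u w} →
                         u ∈ U T → w ∈ U T → u ≢ w → ∃ λ y → E u y × y ∈ U T
connSubgraph-neighbour T {u} {w} u∈U w∈U u≢w with conn T u w u∈U w∈U
... | zero  , []                  = ⊥-elim (u≢w refl)
... | suc _ , _∷_ {y = y} e _     = y , proj₁ (F-edge T u y e) , proj₂ (proj₂ (F-edge T u y e))

-- Steiner trees

module _ {n} {E : Rel n} (E-sym : ∀ {a b} → E a b → E b a) {W : Subset n} where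

  steinerTree-∣U∣≤ : (T : ConnSubgraph E W) → IsSteinerTree E W T → Nonempty W →
                     ∀ {U′} → Arborescence E U′ → W ⊆ U′ → ∣ U T ∣ ≤ ∣ U′ ∣
  steinerTree-∣U∣≤ T minimal (w , w∈W) {U′} A W⊆U′ = begin
    ∣ U T ∣                                 ≤⟨ connSubgraph-∣U∣≤1+edgeCount T (contains T w∈W) ⟩
    suc (edgeCount (F T))                   ≤⟨ s≤s (minimal (Arborescence.spanningTree A E-sym W⊆U′)) ⟩
    suc (edgeCount (Arborescence.treeEdge A)) ≤⟨ Arborescence.spanningTree-edgeCount A ⟩
    ∣ U′ ∣                                  ∎
    where open ≤-Reasoning

  spanningTree-isSteinerTree : Nonempty W → ∀ {U′} (A : Arborescence E U′) (W⊆U′ : W ⊆ U′) →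
                               (∀ T → ∣ U′ ∣ ≤ ∣ U T ∣) →
                               IsSteinerTree E W (Arborescence.spanningTree A E-sym W⊆U′)
  spanningTree-isSteinerTree (w , w∈W) {U′} A W⊆U′ smallest T = ≤-pred (begin
    suc (edgeCount (Arborescence.treeEdge A)) ≤⟨ Arborescence.spanningTree-edgeCount A ⟩
    ∣ U′ ∣                                  ≤⟨ smallest T ⟩
    ∣ U T ∣                                 ≤⟨ connSubgraph-∣U∣≤1+edgeCount T (contains T w∈W) ⟩
    suc (edgeCount (F T))                   ∎)
    where open ≤-Reasoning

  spanned-steinerSet⇒full : IsSteinerSet E W → Arborescence E W → ∀ v → v ∈ W
  spanned-steinerSet⇒full steiner A v with v ∈? W
  ... | yes v∈W = v∈W
  ... | no  v∉W with steiner v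
  ...   | nonempty , T , minimal , v∈T =
    ⊥-elim (<⇒≱ (p⊂q⇒∣p∣<∣q∣ (contains T , v , v∈T , v∉W)) (steinerTree-∣U∣≤ T minimal nonempty A ⊆-refl))

-- Geodetic intervals in graphs of diameter 2

Diameter≤2 : ∀ {n} → Rel n → Set
Diameter≤2 {n} E = ∀ (x y : Fin n) → Σ ℕ λ d → d ≤ 2 × Walk E x y d

record Midpoint {n} (E : Rel n) (S : Subset n) (v : Fin n) : Set where
  constructor midpoint
  field
    x y : Fin n
    x∈S : x ∈ S
    y∈S : y ∈ S
    x≢y : x ≢ y
    x≁y : ¬ E x y
    x∼v : E x v
    v∼y : E v y

module _ {n} {E : Rel n} {S : Subset n} where

  member⇒inInterval : ∀ {v} → v ∈ S → InInterval E S v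
  member⇒inInterval {v} v∈S = v , v , v∈S , v∈S , 0 , [] , (λ _ ()) , refl

  midpoint⇒inInterval : ∀ {v} → Midpoint E S v → InInterval E S v
  midpoint⇒inInterval (midpoint x y x∈S y∈S x≢y x≁y x∼v v∼y) =
    x , y , x∈S , y∈S , 2 , x∼v ∷ v∼y ∷ [] , shortest , inj₂ (inj₁ refl)
    where
    shortest : ∀ m → m < 2 → ¬ Walk E x y m
    shortest zero          _ []         = x≢y refl
    shortest (suc zero)    _ (e ∷ [])   = x≁y e
    shortest (suc (suc _)) (s≤s (s≤s ()))

  shortest≤2 : Diameter≤2 E → ∀ {x y k} (w : Walk E x y k) → IsShortest w → k ≤ 2
  shortest≤2 diameter {x} {y} {k} _ shortest with diameter x y
  ... | d , d≤2 , w′ = ≮⇒≥ λ 2<k → shortest d (≤-trans (s≤s d≤2) 2<k) w′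

  inInterval⇒midpoint : Diameter≤2 E → ∀ {v} → InInterval E S v → v ∉ S → Midpoint E S v
  inInterval⇒midpoint diameter (x , y , x∈S , y∈S , k , w , shortest , v∈w) v∉S with splitʷ _ w v∈w
  ... | zero , _ , [] , _ , _ = ⊥-elim (v∉S x∈S)
  ... | _ , zero , _ , [] , _ = ⊥-elim (v∉S y∈S)
  ... | suc zero , suc zero , x∼v ∷ [] , v∼y ∷ [] , refl =
    midpoint x y x∈S y∈S (λ x≡y → shortest 0 (s≤s z≤n) (subst (λ z → Walk E x z 0) x≡y []))
                         (λ x∼y → shortest 1 (s≤s (s≤s z≤n)) (x∼y ∷ [])) x∼v v∼y
  ... | suc (suc k₁) , suc k₂ , _ , _ , refl with shortest≤2 diameter w shortest
  ...   | s≤s (s≤s k₁+1+k₂≤0) with ≤-trans (m≤n+m (suc k₂) k₁) k₁+1+k₂≤0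
  ...     | ()
  inInterval⇒midpoint diameter (_ , _ , _ , _ , _ , w , shortest , _) _
    | suc zero , suc (suc k₂) , _ , _ , refl with shortest≤2 diameter w shortest
  ...   | s≤s (s≤s ())

-- The example

data Class : Set where
  L A H B R : Class

position : Class → ℚ
position L = 0ℚ
position A = ½
position H = 1ℚ
position B = 1ℚ +ℚ ½
position R = 1ℚ +ℚ 1ℚ

Overlap : Class → Class → Set
Overlap c d = (position c ≤ℚ position d +ℚ 1ℚ) × (position d ≤ℚ position c +ℚ 1ℚ)

overlap? : ∀ c d → Dec (Overlap c d)
overlap? c d = (position c ≤ℚ? position d +ℚ 1ℚ) ×-dec (position d ≤ℚ? position c +ℚ 1ℚ)

adj : Class → Class → Bool
adj c d = does (overlap? c d)

isEnd : Class → Bool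
isEnd L = true
isEnd R = true
isEnd _ = false

endOrA endOrB : Class → Bool
endOrA A = true
endOrA c = isEnd c
endOrB B = true
endOrB c = isEnd c

≡A? : ∀ c → Dec (c ≡ A)
≡A? A = yes refl
≡A? L = no λ ()
≡A? H = no λ ()
≡A? B = no λ ()
≡A? R = no λ ()

≡B? : ∀ c → Dec (c ≡ B)
≡B? B = yes refl
≡B? L = no λ ()
≡B? A = no λ ()
≡B? H = no λ ()
≡B? R = no λ ()

adj-H : ∀ c → adj c H ≡ true
adj-H L = refl
adj-H A = refl
adj-H H = refl
adj-H B = refl
adj-H R = refl

core-clique : ∀ c d → isEnd c ≡ false → isEnd d ≡ false → adj c d ≡ true
core-clique L _ () _
core-clique R _ () _
core-clique _ L _ ()
core-clique _ R _ ()
core-clique A A _ _ = refl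
core-clique A H _ _ = refl
core-clique A B _ _ = refl
core-clique H A _ _ = refl
core-clique H H _ _ = refl
core-clique H B _ _ = refl
core-clique B A _ _ = refl
core-clique B H _ _ = refl
core-clique B B _ _ = refl

A-neighbours : ∀ c d → adj c A ≡ true → adj A d ≡ true → adj c d ≡ false → c ≡ B ⊎ d ≡ B
A-neighbours R _ () _ _
A-neighbours _ R _ () _
A-neighbours L B _ _ _ = inj₂ refl
A-neighbours B L _ _ _ = inj₁ refl
A-neighbours L L _ _ ()
A-neighbours L A _ _ ()
A-neighbours L H _ _ ()
A-neighbours A L _ _ ()
A-neighbours A A _ _ ()
A-neighbours A H _ _ ()
A-neighbours A B _ _ ()
A-neighbours H L _ _ ()
A-neighbours H A _ _ ()
A-neighbours H H _ _ ()
A-neighbours H B _ _ ()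
A-neighbours B A _ _ ()
A-neighbours B H _ _ ()
A-neighbours B B _ _ ()

B-neighbours : ∀ c d → adj c B ≡ true → adj B d ≡ true → adj c d ≡ false → c ≡ A ⊎ d ≡ A
B-neighbours L _ () _ _
B-neighbours _ L _ () _
B-neighbours A R _ _ _ = inj₁ refl
B-neighbours R A _ _ _ = inj₂ refl
B-neighbours A A _ _ ()
B-neighbours A H _ _ ()
B-neighbours A B _ _ ()
B-neighbours H A _ _ ()
B-neighbours H H _ _ ()
B-neighbours H B _ _ ()
B-neighbours H R _ _ ()
B-neighbours B A _ _ ()
B-neighbours B H _ _ ()
B-neighbours B B _ _ ()
B-neighbours B R _ _ ()
B-neighbours R H _ _ ()
B-neighbours R B _ _ ()
B-neighbours R R _ _ ()

core-endOrA : ∀ c → endOrA c ≡ false → isEnd c ≡ false × adj R c ≡ true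
core-endOrA H _ = refl , refl
core-endOrA B _ = refl , refl
core-endOrA L ()
core-endOrA A ()
core-endOrA R ()

endOrA⇒ : ∀ c → endOrA c ≡ true → isEnd c ≡ true ⊎ adj R c ≡ false
endOrA⇒ L _ = inj₁ refl
endOrA⇒ R _ = inj₁ refl
endOrA⇒ A _ = inj₂ refl
endOrA⇒ H ()
endOrA⇒ B ()

endOrB⇒ : ∀ c → endOrB c ≡ true → isEnd c ≡ true ⊎ adj L c ≡ false
endOrB⇒ L _ = inj₁ refl
endOrB⇒ R _ = inj₁ refl
endOrB⇒ B _ = inj₂ refl
endOrB⇒ H ()
endOrB⇒ A ()

R-neighbour-endOrA : ∀ c → adj R c ≡ true → isEnd c ≡ false → endOrA c ≡ false
R-neighbour-endOrA H _ _ = refl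
R-neighbour-endOrA B _ _ = refl
R-neighbour-endOrA L () _
R-neighbour-endOrA A () _
R-neighbour-endOrA R _ ()

pairs : ∀ m → Vec Class (m * 2)
pairs zero    = []
pairs (suc m) = A ∷ B ∷ pairs m

pairs-core : ∀ m (x : Fin (m * 2)) → isEnd (lookup (pairs m) x) ≡ false
pairs-core (suc m) zero          = refl
pairs-core (suc m) (suc zero)    = refl
pairs-core (suc m) (suc (suc x)) = pairs-core m x

∣∷∣ : ∀ {n} b (p : Subset n) → ∣ b ∷ p ∣ ≡ boolToℕ b + ∣ p ∣
∣∷∣ true  _ = refl
∣∷∣ false _ = refl

∣map-pairs∣ : ∀ (P : Class → Bool) m → ∣ map P (pairs m) ∣ ≡ m * (boolToℕ (P A) + boolToℕ (P B))
∣map-pairs∣ P zero    = refl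
∣map-pairs∣ P (suc m) = begin
  ∣ P A ∷ P B ∷ map P (pairs m) ∣                  ≡⟨ ∣∷∣ (P A) (P B ∷ map P (pairs m)) ⟩
  ⟦ P A ⟧ + ∣ P B ∷ map P (pairs m) ∣              ≡⟨ cong (⟦ P A ⟧ +_) (∣∷∣ (P B) (map P (pairs m))) ⟩
  ⟦ P A ⟧ + (⟦ P B ⟧ + ∣ map P (pairs m) ∣)        ≡⟨ cong (λ s → ⟦ P A ⟧ + (⟦ P B ⟧ + s)) (∣map-pairs∣ P m) ⟩
  ⟦ P A ⟧ + (⟦ P B ⟧ + m * (⟦ P A ⟧ + ⟦ P B ⟧))    ≡⟨ sym (+-assoc ⟦ P A ⟧ ⟦ P B ⟧ _) ⟩
  (⟦ P A ⟧ + ⟦ P B ⟧) + m * (⟦ P A ⟧ + ⟦ P B ⟧)    ∎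
  where
  open ≡-Reasoning
  ⟦_⟧ : Bool → ℕ
  ⟦_⟧ = boolToℕ

module Example (k : ℕ) where

  -- With a single A and a single B, {L, R, B} would already be geodetic.
  m : ℕ
  m = 2 + k

  n : ℕ
  n = 3 + m * 2

  V : Set
  V = Fin n

  layout : Vec Class n
  layout = L ∷ R ∷ H ∷ pairs m

  class : V → Class
  class = lookup layout

  positions : V → ℚ
  positions v = position (class v)

  E : Rel n
  E = UIAdj positions

  ℓ ρ h a₁ b₁ a₂ b₂ : V
  ℓ  = zero
  ρ  = suc zero
  h  = suc (suc zero)
  a₁ = suc (suc (suc zero))
  b₁ = suc (suc (suc (suc zero)))
  a₂ = suc (suc (suc (suc (suc zero))))
  b₂ = suc (suc (suc (suc (suc (suc zero)))))

  E-intro : ∀ {u v} → u ≢ v → adj (class u) (class v) ≡ true → E u v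
  E-intro {u} {v} u≢v u∼v = u≢v , does-true (overlap? (class u) (class v)) u∼v

  E⇒adj : ∀ {u v} → E u v → adj (class u) (class v) ≡ true
  E⇒adj {u} {v} (_ , u∼v) = dec-true (overlap? (class u) (class v)) u∼v

  ¬E : ∀ {u v} → adj (class u) (class v) ≡ false → ¬ E u v
  ¬E u≁v u∼v with trans (sym (E⇒adj u∼v)) u≁v
  ... | ()

  E-sym : ∀ {u v} → E u v → E v u
  E-sym (u≢v , u≤v+1 , v≤u+1) = u≢v ∘ sym , v≤u+1 , u≤v+1

  E? : ∀ u v → Dec (E u v)
  E? u v = ¬? (u ≟ v) ×-dec overlap? (class u) (class v)

  ≢-by-class : ∀ {u v c d} → class u ≡ c → class v ≡ d → c ≢ d → u ≢ v
  ≢-by-class refl refl c≢d u≡v = c≢d (cong class u≡v)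

  E-by-class : ∀ {u v c d} → class u ≡ c → class v ≡ d → c ≢ d → adj c d ≡ true → E u v
  E-by-class refl refl c≢d c∼d = E-intro (≢-by-class refl refl c≢d) c∼d

  core-E : ∀ {u v} → isEnd (class u) ≡ false → isEnd (class v) ≡ false → u ≢ v → E u v
  core-E u-core v-core u≢v = E-intro u≢v (core-clique _ _ u-core v-core)

  E-h : ∀ {u} → u ≢ h → E u h
  E-h {u} u≢h = E-intro u≢h (adj-H (class u))

  diameter≤2 : Diameter≤2 E
  diameter≤2 x y with x ≟ h | y ≟ h
  ... | yes refl | yes refl = 0 , z≤n , []
  ... | yes refl | no  y≢h  = 1 , s≤s z≤n , E-sym (E-h y≢h) ∷ []
  ... | no  x≢h  | yes refl = 1 , s≤s z≤n , E-h x≢h ∷ []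
  ... | no  x≢h  | no  y≢h  = 2 , ≤-refl , E-h x≢h ∷ E-sym (E-h y≢h) ∷ []

  end-vertex : ∀ {u} → isEnd (class u) ≡ true → u ≡ ℓ ⊎ u ≡ ρ
  end-vertex {zero}              _   = inj₁ refl
  end-vertex {suc zero}          _   = inj₂ refl
  end-vertex {suc (suc zero)}    ()
  end-vertex {suc (suc (suc x))} end with trans (sym end) (pairs-core m x)
  ... | ()

  ends-nonadjacent : ∀ {u v} → isEnd (class u) ≡ true → isEnd (class v) ≡ true → ¬ E u v
  ends-nonadjacent {u} {v} u-end v-end u∼v with end-vertex {u} u-end | end-vertex {v} v-end
  ... | inj₁ refl | inj₁ refl = proj₁ u∼v refl
  ... | inj₂ refl | inj₂ refl = proj₁ u∼v refl
  ... | inj₁ refl | inj₂ refl = ¬E refl u∼v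
  ... | inj₂ refl | inj₁ refl = ¬E refl u∼v

  end≢core : ∀ {u v} → isEnd (class u) ≡ true → isEnd (class v) ≡ false → u ≢ v
  end≢core u-end v-core refl with trans (sym u-end) v-core
  ... | ()

  end-neighbour-core : ∀ {u v} → isEnd (class u) ≡ true → E u v → isEnd (class v) ≡ false
  end-neighbour-core {v = v} u-end u∼v with isEnd (class v) in v-end
  ... | false = refl
  ... | true  = ⊥-elim (ends-nonadjacent u-end v-end u∼v)

  nonadjacent : ∀ {u v} → u ≢ v → ¬ E u v → adj (class u) (class v) ≡ false
  nonadjacent {u} {v} u≢v u≁v = dec-false (overlap? (class u) (class v)) λ o → u≁v (u≢v , o)

  module _ {S : Subset n} where

    ends∈geodetic : IsGeodetic E S → ∀ {v} → isEnd (class v) ≡ true → v ∈ S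
    ends∈geodetic geodetic {v} v-end with v ∈? S
    ... | yes v∈S = v∈S
    ... | no  v∉S with inInterval⇒midpoint diameter≤2 (geodetic v) v∉S
    ...   | midpoint _ _ _ _ x≢y x≁y x∼v v∼y =
      ⊥-elim (x≁y (core-E (end-neighbour-core v-end (E-sym x∼v)) (end-neighbour-core v-end v∼y) x≢y))

    A-midpoint⇒B∈ : ∀ {v} → class v ≡ A → Midpoint E S v → ∃ λ b → b ∈ S × class b ≡ B
    A-midpoint⇒B∈ v-A (midpoint x y x∈S y∈S x≢y x≁y x∼v v∼y)
      with A-neighbours (class x) (class y) (subst (λ c → adj (class x) c ≡ true) v-A (E⇒adj x∼v))
                        (subst (λ c → adj c (class y) ≡ true) v-A (E⇒adj v∼y)) (nonadjacent x≢y x≁y)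
    ... | inj₁ x-B = x , x∈S , x-B
    ... | inj₂ y-B = y , y∈S , y-B

    B-midpoint⇒A∈ : ∀ {v} → class v ≡ B → Midpoint E S v → ∃ λ a → a ∈ S × class a ≡ A
    B-midpoint⇒A∈ v-B (midpoint x y x∈S y∈S x≢y x≁y x∼v v∼y)
      with B-neighbours (class x) (class y) (subst (λ c → adj (class x) c ≡ true) v-B (E⇒adj x∼v))
                        (subst (λ c → adj c (class y) ≡ true) v-B (E⇒adj v∼y)) (nonadjacent x≢y x≁y)
    ... | inj₁ x-A = x , x∈S , x-A
    ... | inj₂ y-A = y , y∈S , y-A

    noA⇒B∈ : IsGeodetic E S → ¬ (∃ λ a → a ∈ S × class a ≡ A) → ∀ {b} → class b ≡ B → b ∈ S
    noA⇒B∈ geodetic noA {b} b-B with b ∈? S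
    ... | yes b∈S = b∈S
    ... | no  b∉S = ⊥-elim (noA (B-midpoint⇒A∈ b-B (inInterval⇒midpoint diameter≤2 (geodetic b) b∉S)))

    noB⇒A∈ : IsGeodetic E S → ¬ (∃ λ b → b ∈ S × class b ≡ B) → ∀ {a} → class a ≡ A → a ∈ S
    noB⇒A∈ geodetic noB {a} a-A with a ∈? S
    ... | yes a∈S = a∈S
    ... | no  a∉S = ⊥-elim (noB (A-midpoint⇒B∈ a-A (inInterval⇒midpoint diameter≤2 (geodetic a) a∉S)))

    four≤∣S∣ : ∀ {x y} → ℓ ∈ S → ρ ∈ S → x ∈ S → y ∈ S →
               isEnd (class x) ≡ false → isEnd (class y) ≡ false → x ≢ y → 4 ≤ ∣ S ∣
    four≤∣S∣ ℓ∈S ρ∈S x∈S y∈S x-core y-core x≢y =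
      unique⇒length≤∣p∣
        (((λ ()) ∷ end≢core refl x-core ∷ end≢core refl y-core ∷ []) ∷
         (end≢core refl x-core ∷ end≢core refl y-core ∷ []) ∷ (x≢y ∷ []) ∷ [] ∷ [])
        (ℓ∈S ∷ ρ∈S ∷ x∈S ∷ y∈S ∷ [])

    geodetic-size : IsGeodetic E S → 4 ≤ ∣ S ∣
    geodetic-size geodetic =
      two-core-members (any? λ a → a ∈? S ×-dec ≡A? (class a)) (any? λ b → b ∈? S ×-dec ≡B? (class b))
      where
      four : ∀ {x y} → x ∈ S → y ∈ S → isEnd (class x) ≡ false → isEnd (class y) ≡ false → x ≢ y → 4 ≤ ∣ S ∣
      four = four≤∣S∣ (ends∈geodetic geodetic {ℓ} refl) (ends∈geodetic geodetic {ρ} refl)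
      two-core-members : Dec (∃ λ a → a ∈ S × class a ≡ A) → Dec (∃ λ b → b ∈ S × class b ≡ B) → 4 ≤ ∣ S ∣
      two-core-members (yes (a , a∈S , a-A)) (yes (b , b∈S , b-B)) =
        four a∈S b∈S (cong isEnd a-A) (cong isEnd b-B) (≢-by-class a-A b-B λ ())
      two-core-members (no noA) _ =
        four (noA⇒B∈ geodetic noA {b₁} refl) (noA⇒B∈ geodetic noA {b₂} refl) refl refl λ ()
      two-core-members (yes _) (no noB) =
        four (noB⇒A∈ geodetic noB {a₁} refl) (noB⇒A∈ geodetic noB {a₂} refl) refl refl λ ()

  -- S₀ = {ℓ, ρ, a₁, b₁}
  S₀ : Subset n
  S₀ = inside ∷ inside ∷ outside ∷ inside ∷ inside ∷ Subset.⊥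

  ∣S₀∣≡4 : ∣ S₀ ∣ ≡ 4
  ∣S₀∣≡4 = cong (4 +_) (∣⊥∣≡0 (2 + k * 2))

  S₀-geodetic : IsGeodetic E S₀
  S₀-geodetic v = by-class (class v) refl
    where
    ℓ∈S₀ : ℓ ∈ S₀
    ℓ∈S₀ = here
    ρ∈S₀ : ρ ∈ S₀
    ρ∈S₀ = there here
    a₁∈S₀ : a₁ ∈ S₀
    a₁∈S₀ = there (there (there here))
    b₁∈S₀ : b₁ ∈ S₀
    b₁∈S₀ = there (there (there (there here)))
    end∈S₀ : isEnd (class v) ≡ true → InInterval E S₀ v
    end∈S₀ v-end with end-vertex {v} v-end
    ... | inj₁ refl = member⇒inInterval ℓ∈S₀
    ... | inj₂ refl = member⇒inInterval ρ∈S₀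
    by-class : ∀ c → class v ≡ c → InInterval E S₀ v
    by-class L v-L = end∈S₀ (cong isEnd v-L)
    by-class R v-R = end∈S₀ (cong isEnd v-R)
    by-class H v-H = midpoint⇒inInterval (midpoint ℓ ρ ℓ∈S₀ ρ∈S₀ (λ ()) (¬E refl)
      (E-by-class refl v-H (λ ()) refl) (E-by-class v-H refl (λ ()) refl))
    by-class A v-A = midpoint⇒inInterval (midpoint ℓ b₁ ℓ∈S₀ b₁∈S₀ (λ ()) (¬E refl)
      (E-by-class refl v-A (λ ()) refl) (E-by-class v-A refl (λ ()) refl))
    by-class B v-B = midpoint⇒inInterval (midpoint a₁ ρ a₁∈S₀ ρ∈S₀ (λ ()) (¬E refl)
      (E-by-class refl v-B (λ ()) refl) (E-by-class v-B refl (λ ()) refl))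

  geodeticNumber : IsGeodeticNumber E 4
  geodeticNumber = (S₀ , S₀-geodetic , ∣S₀∣≡4) , λ _ → geodetic-size

  classSet : (Class → Bool) → Subset n
  classSet P = map P layout

  ∈classSet : ∀ {P v} → P (class v) ≡ true → v ∈ classSet P
  ∈classSet {P} {v} Pv = lookup⇒[]= v (classSet P) (trans (lookup-map v P layout) Pv)

  ∈classSet⁻ : ∀ {P v} → v ∈ classSet P → P (class v) ≡ true
  ∈classSet⁻ {P} {v} v∈ = trans (sym (lookup-map v P layout)) ([]=⇒lookup v∈)

  ∣classSet-endOrA∣ : ∣ classSet endOrA ∣ ≡ 2 + m
  ∣classSet-endOrA∣ = cong (2 +_) (trans (∣map-pairs∣ endOrA m) (*-identityʳ m))

  ∣classSet-endOrB∣ : ∣ classSet endOrB ∣ ≡ 2 + m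
  ∣classSet-endOrB∣ = cong (2 +_) (trans (∣map-pairs∣ endOrB m) (*-identityʳ m))

  arborescence : ∀ {U′ z} → z ∈ U′ → isEnd (class z) ≡ false →
                 (∀ {x} → isEnd (class x) ≡ true → x ∈ U′ → ∃ λ y → y ∈ U′ × E x y) → Arborescence E U′
  arborescence {U′} {z} z∈U′ z-core end-neighbour = record
    { root          = z
    ; root∈U        = z∈U′
    ; parent        = proj₁ parent
    ; height        = height
    ; parent-edge   = λ u∈U′ u≢z → proj₁ (proj₂ parent (u∈U′ , u≢z))
    ; parent∈U      = λ u∈U′ u≢z → proj₁ (proj₂ (proj₂ parent (u∈U′ , u≢z)))
    ; height-parent = λ u∈U′ u≢z → proj₂ (proj₂ (proj₂ parent (u∈U′ , u≢z)))
    }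
    where
    height : V → ℕ
    height u = boolToℕ (not (does (u ≟ z))) + boolToℕ (isEnd (class u))

    height-nonroot : ∀ {u} → u ≢ z → height u ≡ 1 + boolToℕ (isEnd (class u))
    height-nonroot {u} u≢z = cong (λ b → boolToℕ (not b) + boolToℕ (isEnd (class u))) (dec-false (u ≟ z) u≢z)

    height-core : ∀ {u} → isEnd (class u) ≡ false → height u ≤ 1
    height-core {u} u-core =
      subst (λ e → boolToℕ (not (does (u ≟ z))) + boolToℕ e ≤ 1) (sym u-core)
            (≤-trans (≤-reflexive (+-identityʳ _)) (boolToℕ≤1 _))

    height-root : height z ≡ 0
    height-root = cong₂ (λ b e → boolToℕ (not b) + boolToℕ e) (dec-true (z ≟ z) refl) z-core

    step : ∀ {u} → u ∈ U′ × u ≢ z → ∃ λ w → E u w × w ∈ U′ × height w < height u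
    step {u} (u∈U′ , u≢z) = by-role (isEnd (class u)) refl
      where
      by-role : ∀ b → isEnd (class u) ≡ b → ∃ λ w → E u w × w ∈ U′ × height w < height u
      by-role true u-end with end-neighbour u-end u∈U′
      ... | y , y∈U′ , u∼y = y , u∼y , y∈U′ ,
        ≤-trans (s≤s (height-core {y} (end-neighbour-core u-end u∼y)))
                (≤-reflexive (sym (trans (height-nonroot u≢z) (cong (λ e → 1 + boolToℕ e) u-end))))
      by-role false u-core = z , core-E u-core z-core u≢z , z∈U′ ,
        subst₂ _<_ (sym height-root) (sym (trans (height-nonroot u≢z) (cong (λ e → 1 + boolToℕ e) u-core)))
               (s≤s z≤n)

    parent : Σ (V → V) λ p → ∀ {u} → u ∈ U′ × u ≢ z → E u (p u) × p u ∈ U′ × height (p u) < height u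
    parent = choice (λ u → u ∈? U′ ×-dec ¬? (u ≟ z)) step

  module _ {W : Subset n} (steiner : IsSteinerSet E W) where

    ends∈steinerSet : ∀ {X} → isEnd (class X) ≡ true → X ∈ W
    ends∈steinerSet {X} X-end with X ∈? W
    ... | yes X∈W = X∈W
    ... | no  X∉W = ⊥-elim (no-tree (steiner X))
      where
      no-tree : ¬ InSteinerInterval E W X
      no-tree ((w , w∈W) , T , minimal , X∈T)
        with connSubgraph-neighbour T X∈T (contains T w∈W) (λ X≡w → X∉W (subst (_∈ W) (sym X≡w) w∈W))
      ... | z , X∼z , z∈T =
        <⇒≱ (x∈p⇒∣p-x∣<∣p∣ X∈T) (steinerTree-∣U∣≤ E-sym T minimal (w , w∈W) spanning W⊆U′)
        where
        z-core : isEnd (class z) ≡ false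
        z-core = end-neighbour-core X-end X∼z
        neighbour : ∀ {Y} → isEnd (class Y) ≡ true → Y ∈ U T - X → ∃ λ y → y ∈ U T - X × E Y y
        neighbour Y-end Y∈U′ with connSubgraph-neighbour T (p─q⊆p (U T) ⁅ X ⁆ Y∈U′) z∈T (end≢core Y-end z-core)
        ... | y , Y∼y , y∈T =
          y , x∈p∧x≢y⇒x∈p-y y∈T (λ y≡X → ends-nonadjacent Y-end X-end (subst (E _) y≡X Y∼y)) , Y∼y
        spanning : Arborescence E (U T - X)
        spanning = arborescence (x∈p∧x≢y⇒x∈p-y z∈T (end≢core X-end z-core ∘ sym)) z-core neighbour
        W⊆U′ : W ⊆ U T - X
        W⊆U′ u∈W = x∈p∧x≢y⇒x∈p-y (contains T u∈W) λ u≡X → X∉W (subst (_∈ W) u≡X u∈W)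

    ends-have-neighbours⇒full : (∃ λ a → a ∈ W × E ℓ a) → (∃ λ b → b ∈ W × E ρ b) → ∀ v → v ∈ W
    ends-have-neighbours⇒full (a , a∈W , ℓ∼a) (b , b∈W , ρ∼b) =
      spanned-steinerSet⇒full E-sym steiner (arborescence a∈W (end-neighbour-core {ℓ} refl ℓ∼a) neighbour)
      where
      neighbour : ∀ {x} → isEnd (class x) ≡ true → x ∈ W → ∃ λ y → y ∈ W × E x y
      neighbour {x} x-end _ with end-vertex {x} x-end
      ... | inj₁ refl = a , a∈W , ℓ∼a
      ... | inj₂ refl = b , b∈W , ρ∼b

    nonneighbours∈ : ∀ {X} → isEnd (class X) ≡ true → ¬ (∃ λ u → u ∈ W × E X u) →
                     ∀ {v} → adj (class X) (class v) ≡ false → v ∈ W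
    nonneighbours∈ {X} X-end lonely {v} X≁v with v ∈? W
    ... | yes v∈W = v∈W
    ... | no  v∉W = ⊥-elim (no-tree (steiner v))
      where
      X∈W : X ∈ W
      X∈W = ends∈steinerSet X-end
      no-tree : ¬ InSteinerInterval E W v
      no-tree (nonempty , T , minimal , v∈T)
        with connSubgraph-neighbour T (contains T X∈W) v∈T (λ X≡v → v∉W (subst (_∈ W) X≡v X∈W))
      ... | y , X∼y , y∈T = <⇒≱ two-outside (≤-trans at-most-one-outside (∣⁅x⁆∪p∣≤1+∣p∣ h W))
        where
        at-most-one-outside : ∣ U T ∣ ≤ ∣ ⁅ h ⁆ ∪ W ∣
        at-most-one-outside = steinerTree-∣U∣≤ E-sym T minimal nonempty
          (arborescence (x∈p∪q⁺ (inj₁ (x∈⁅x⁆ h))) refl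
             λ {x} x-end _ → h , x∈p∪q⁺ (inj₁ (x∈⁅x⁆ h)) , E-h (end≢core x-end refl))
          (q⊆p∪q ⁅ h ⁆ W)
        two-outside : suc (suc ∣ W ∣) ≤ ∣ U T ∣
        two-outside = ≤-trans (s≤s (∣p∣<∣⁅x⁆∪p∣ v∉W))
          (≤-trans (∣p∣<∣⁅x⁆∪p∣ (∉⁅x⁆∪p (λ y≡v → ¬E X≁v (subst (E X) y≡v X∼y)) (λ y∈W → lonely (y , y∈W , X∼y))))
                   (p⊆q⇒∣p∣≤∣q∣ (⁅x⁆∪p⊆q y∈T (⁅x⁆∪p⊆q v∈T (contains T)))))

    steinerSet-size : 2 + m ≤ ∣ W ∣
    steinerSet-size = by-neighbours (any? λ a → a ∈? W ×-dec E? ℓ a) (any? λ b → b ∈? W ×-dec E? ρ b)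
      where
      cover : ∀ P → ∣ classSet P ∣ ≡ 2 + m → (∀ {v} → P (class v) ≡ true → v ∈ W) → 2 + m ≤ ∣ W ∣
      cover P ∣P∣≡2+m P⊆W = subst (_≤ ∣ W ∣) ∣P∣≡2+m (p⊆q⇒∣p∣≤∣q∣ λ {v} v∈ → P⊆W (∈classSet⁻ {P} {v} v∈))
      by-neighbours : Dec (∃ λ a → a ∈ W × E ℓ a) → Dec (∃ λ b → b ∈ W × E ρ b) → 2 + m ≤ ∣ W ∣
      by-neighbours (yes ℓ-nbr) (yes ρ-nbr) =
        cover endOrA ∣classSet-endOrA∣ λ {v} _ → ends-have-neighbours⇒full ℓ-nbr ρ-nbr v
      by-neighbours _ (no ρ-lonely) = cover endOrA ∣classSet-endOrA∣ λ {v} v-endOrA →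
        [ ends∈steinerSet , nonneighbours∈ {ρ} refl ρ-lonely ]′ (endOrA⇒ (class v) v-endOrA)
      by-neighbours (no ℓ-lonely) (yes _) = cover endOrB ∣classSet-endOrB∣ λ {v} v-endOrB →
        [ ends∈steinerSet , nonneighbours∈ {ℓ} refl ℓ-lonely ]′ (endOrB⇒ (class v) v-endOrB)

  W₀ : Subset n
  W₀ = classSet endOrA

  -- Every vertex x of class H or B lies on a Steiner W₀-tree: ℓ hangs on a₁, ρ on x and the
  -- A-vertices on x; no tree can do with fewer vertices, as ρ has no neighbour in W₀.
  steinerTree-through : ∀ {x} → isEnd (class x) ≡ false → adj R (class x) ≡ true →
                        Σ (ConnSubgraph E W₀) λ T → IsSteinerTree E W₀ T × x ∈ U T
  steinerTree-through {x} x-core ρ∼x =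
    Arborescence.spanningTree spanning E-sym W₀⊆U′ ,
    spanningTree-isSteinerTree E-sym (ℓ , ∈classSet refl) spanning W₀⊆U′ smallest ,
    x∈p∪q⁺ (inj₁ (x∈⁅x⁆ x))
    where
    W₀⊆U′ : W₀ ⊆ ⁅ x ⁆ ∪ W₀
    W₀⊆U′ = q⊆p∪q ⁅ x ⁆ W₀
    neighbour : ∀ {y} → isEnd (class y) ≡ true → y ∈ ⁅ x ⁆ ∪ W₀ → ∃ λ z → z ∈ ⁅ x ⁆ ∪ W₀ × E y z
    neighbour {y} y-end _ with end-vertex {y} y-end
    ... | inj₁ refl = a₁ , W₀⊆U′ (∈classSet refl) , E-by-class refl refl (λ ()) refl
    ... | inj₂ refl = x , x∈p∪q⁺ (inj₁ (x∈⁅x⁆ x)) , E-intro (end≢core refl x-core) ρ∼x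
    spanning : Arborescence E (⁅ x ⁆ ∪ W₀)
    spanning = arborescence (x∈p∪q⁺ (inj₁ (x∈⁅x⁆ x))) x-core neighbour
    smallest : ∀ T → ∣ ⁅ x ⁆ ∪ W₀ ∣ ≤ ∣ U T ∣
    smallest T with connSubgraph-neighbour T (contains T (∈classSet {endOrA} {ρ} refl))
                                             (contains T (∈classSet {endOrA} {ℓ} refl)) (λ ())
    ... | y , ρ∼y , y∈T = ≤-trans (∣⁅x⁆∪p∣≤1+∣p∣ x W₀)
      (≤-trans (∣p∣<∣⁅x⁆∪p∣ y∉W₀) (p⊆q⇒∣p∣≤∣q∣ (⁅x⁆∪p⊆q y∈T (contains T))))
      where
      y∉W₀ : y ∉ W₀
      y∉W₀ y∈W₀ with trans (sym (∈classSet⁻ y∈W₀))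
                           (R-neighbour-endOrA (class y) (E⇒adj ρ∼y) (end-neighbour-core {ρ} refl ρ∼y))
      ... | ()

  W₀-steinerSet : IsSteinerSet E W₀
  W₀-steinerSet v = by-class (endOrA (class v)) refl
    where
    by-class : ∀ b → endOrA (class v) ≡ b → InSteinerInterval E W₀ v
    by-class true v∈W₀ =
      let T , minimal , _ = steinerTree-through {h} refl refl
      in (ℓ , ∈classSet refl) , T , minimal , contains T (∈classSet v∈W₀)
    by-class false v∉W₀ =
      let T , minimal , v∈T = steinerTree-through {v} (proj₁ (core-endOrA (class v) v∉W₀)) (proj₂ (core-endOrA (class v) v∉W₀))
      in (ℓ , ∈classSet refl) , T , minimal , v∈T

  steinerNumber : IsSteinerNumber E (2 + m)
  steinerNumber = (W₀ , W₀-steinerSet , ∣classSet-endOrA∣) , λ _ → steinerSet-size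

mainTheorem3 : (Σ ℕ λ n → Σ (Fin n → ℚ) λ p → Σ ℕ λ g → Σ ℕ λ s →
    IsGeodeticNumber (UIAdj p) g × IsSteinerNumber (UIAdj p) s × g ≢ s)
    ×
    (∀ (k : ℕ) → Σ ℕ λ n → Σ (Fin n → ℚ) λ p → Σ ℕ λ g → Σ ℕ λ s →
    IsGeodeticNumber (UIAdj p) g × IsSteinerNumber (UIAdj p) s × k + g ≤ s)
mainTheorem3 =
  (n 1 , positions 1 , 4 , 5 , geodeticNumber 1 , steinerNumber 1 , λ ()) ,
  λ k → n k , positions k , 4 , 4 + k , geodeticNumber k , steinerNumber k , ≤-reflexive (+-comm k 4)
  where open Example
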